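{- Let $n,r\in\mathbb N$ with $n\ge r^2$ and $r\ge2$. If $G$ is an $n$-vertex digraph such that for all distinct $x,y\in V(G)$ with $xy\notin E(G)$ we have $d^+_G(x)+d^-_G(y)>2(1-1/r)n$, then every vertex $z\in V(G)$ lies in a copy of $T_r$ in $G$.
   Context: Digraphs have no loops and at most one edge in each direction between any pair of vertices; $xy$ denotes the edge from $x$ to $y$. $d^+_G$, $d^-_G$ denote out- and in-degree. $T_r$ is the transitive tournament on $r$ vertices. -}

module Defs where

open import Data.Nat using (ℕ; zero; suc; _+_; _*_; _∸_; _<_; _≤_)
open import Data.Bool using (Bool; true; false; if_then_else_)
open import Data.Fin using (Fin; zero; suc)
import Data.Fin as F
open import Data.Product using (Σ; ∃; _×_; _,_)
open import Relation.Binary.PropositionalEquality using (_≡_; _≢_)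
open import Function.Definitions using (Injective)

-- A digraph on vertex set Fin n: adjacency xy ∈ E(G) iff adj x y ≡ true.
-- No loops; at most one edge in each direction is automatic for a Bool relation.
record Digraph (n : ℕ) : Set where
  field
    adj      : Fin n → Fin n → Bool
    loopless : ∀ x → adj x x ≡ false
open Digraph public

count : ∀ {n} → (Fin n → Bool) → ℕ
count {zero}  p = 0
count {suc n} p = (if p zero then 1 else 0) + count (λ i → p (suc i))

outdeg : ∀ {n} → Digraph n → Fin n → ℕ
outdeg G x = count (λ y → adj G x y)

indeg : ∀ {n} → Digraph n → Fin n → ℕ
indeg G y = count (λ x → adj G x y)

-- A copy of T_r in G: an injective map f : Fin r → V(G) such that f i f j is an
-- edge whenever i < j (T_r is the transitive tournament on Fin r ordered by <).
record TransCopy {n : ℕ} (G : Digraph n) (r : ℕ) : Set where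
  field
    emb   : Fin r → Fin n
    inj   : Injective _≡_ _≡_ emb
    edges : ∀ (i j : Fin r) → i F.< j → adj G (emb i) (emb j) ≡ true
open TransCopy public

InTransCopy : ∀ {n} → Digraph n → ℕ → Fin n → Set
InTransCopy G r z = Σ (TransCopy G r) λ T → Σ (Fin _) λ i → emb T i ≡ z

-- Write d̄⁺(x) = n − d⁺(x) and d̄⁻(y) = n − d⁻(y) (these count x and y themselves); the
-- hypothesis says r(d̄⁺(x) + d̄⁻(y)) < 2n for every non-edge xy with x ≠ y. Grow two
-- transitive chains L ⇒ Q through z, keeping r(Σ_{v∈L} d̄⁺(v) + Σ_{v∈Q} d̄⁻(v)) < (k+1)n,
-- where k = |L| + |Q|. Every vertex w outside the non-neighbourhoods counted by this sum
-- satisfies L ⇒ w ⇒ Q. If such a candidate has r d̄⁺(w) < n it is appended to L, if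
-- r d̄⁻(w) < n it is prepended to Q, and the invariant survives. Otherwise every candidate
-- is heavy; two heavy vertices are joined in both directions by the hypothesis, so the
-- candidates form a complete digraph, and since n ≥ r² there are at least r − k of them.
-- The start L = [z] needs r d̄⁺(z) < 2n: apply the hypothesis to a non-out-neighbour y ≠ z,
-- or use r ≤ r² ≤ n if there is none.
module Submission where

open import Defs
open import Data.Bool using (Bool; true; false; not; _∨_)
open import Data.Bool.ListAction using (any)
open import Data.Bool.Properties using (∨-conicalˡ; ∨-conicalʳ; not-injective)
open import Data.Fin using (Fin; zero; suc)
import Data.Fin as F
open import Data.Fin.Properties using (suc-injective; <-cmp; _≟_; toℕ<n)
open import Data.List using (List; []; _∷_; _++_; map; length; take; lookup)
open import Data.List.Membership.Propositional using (_∈_)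
open import Data.List.Membership.Propositional.Properties using (∈-++⁺ˡ; ∈-++⁺ʳ; ∈-lookup)
open import Data.List.Properties
  using (length-map; length-++; length-++-sucʳ; length-take; map-++; ++-assoc)
open import Data.List.Relation.Unary.All as All using (All; []; _∷_)
import Data.List.Relation.Unary.All.Properties as All
open import Data.List.Relation.Unary.AllPairs using (AllPairs; []; _∷_)
import Data.List.Relation.Unary.AllPairs.Properties as AllPairs
open import Data.List.Relation.Unary.Any as Any using (here; there; any?)
open import Data.List.Relation.Unary.Any.Properties using (lookup-index)
open import Data.List.Relation.Unary.Unique.Propositional using (Unique)
import Data.List.Relation.Unary.Unique.Propositional.Properties as Unique
open import Data.Nat
  using (ℕ; zero; suc; pred; _+_; _*_; _∸_; _≤_; _<_; _≤?_; _<?_; z≤n; s≤s; NonZero)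
open import Data.Nat.ListAction using (sum)
open import Data.Nat.ListAction.Properties using (sum-++)
open import Data.Nat.Properties hiding (suc-injective; <-cmp; _≟_)
open import Data.Nat.Tactic.RingSolver using (solve-∀)
open import Data.Product using (∃-syntax; _×_; _,_; proj₁; proj₂; uncurry)
open import Data.Sum as Sum using (_⊎_; inj₁; inj₂; [_,_]; [_,_]′)
open import Function using (_∘_; id; case_of_)
open import Function.Definitions using (Injective)
open import Relation.Binary using (tri<; tri≈; tri>)
open import Relation.Binary.PropositionalEquality
  using (_≡_; _≢_; refl; sym; trans; cong; cong₂; subst; module ≡-Reasoning)
open import Relation.Nullary using (¬_; Dec; yes; no; contradiction)
open import Relation.Nullary.Decidable using (_⊎-dec_)

count-false : ∀ {n} → count {n} (λ _ → false) ≡ 0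
count-false {zero}  = refl
count-false {suc n} = count-false {n}

count-head-true : ∀ {n} {p : Fin (suc n) → Bool} → p zero ≡ true → count p ≡ suc (count (p ∘ suc))
count-head-true p0 rewrite p0 = refl

count-head-false : ∀ {n} {p : Fin (suc n) → Bool} → p zero ≡ false → count p ≡ count (p ∘ suc)
count-head-false p0 rewrite p0 = refl

count-∨ : ∀ {n} (p q : Fin n → Bool) → count (λ i → p i ∨ q i) ≤ count p + count q
count-∨ {zero}  p q = z≤n
count-∨ {suc n} p q with p zero | q zero | count-∨ (p ∘ suc) (q ∘ suc)
... | true  | true  | ih = s≤s (≤-trans ih (+-monoʳ-≤ (count (p ∘ suc)) (n≤1+n _)))
... | true  | false | ih = s≤s ih
... | false | true  | ih = ≤-trans (s≤s ih) (≤-reflexive (sym (+-suc _ _)))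
... | false | false | ih = ih

count-any : ∀ {n} {A : Set} (f : A → Fin n → Bool) (xs : List A)
  → count (λ i → any (λ x → f x i) xs) ≤ sum (map (count ∘ f) xs)
count-any {n} f []       = ≤-reflexive (count-false {n})
count-any f (x ∷ xs) =
  ≤-trans (count-∨ (f x) (λ i → any (λ y → f y i) xs)) (+-monoʳ-≤ (count (f x)) (count-any f xs))

count-+-count-not : ∀ {n} (p : Fin n → Bool) → count p + count (not ∘ p) ≡ n
count-+-count-not {zero}  p = refl
count-+-count-not {suc n} p with p zero | count-+-count-not (p ∘ suc)
... | true  | eq = cong suc eq
... | false | eq = trans (+-suc _ _) (cong suc eq)

record Enumeration {n} (p : Fin n → Bool) : Set where
  field
    elements        : List (Fin n)
    length-elements : length elements ≡ count p
    unique          : Unique elements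
    satisfy         : All (λ i → p i ≡ true) elements

enumerate : ∀ {n} (p : Fin n → Bool) → Enumeration p
enumerate {zero}  p = record { elements = [] ; length-elements = refl ; unique = [] ; satisfy = [] }
enumerate {suc n} p with enumerate (p ∘ suc) | p zero in p0
... | E | true  = record
  { elements        = zero ∷ map suc elements
  ; length-elements = trans (cong suc (trans (length-map suc elements) length-elements))
                        (sym (count-head-true {p = p} p0))
  ; unique          = All.map⁺ (All.universal (λ _ ()) elements) ∷ Unique.map⁺ suc-injective unique
  ; satisfy         = p0 ∷ All.map⁺ satisfy
  }
  where open Enumeration E
... | E | false = record
  { elements        = map suc elements
  ; length-elements = trans (trans (length-map suc elements) length-elements)
                        (sym (count-head-false {p = p} p0))
  ; unique          = Unique.map⁺ suc-injective unique
  ; satisfy         = All.map⁺ satisfy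
  }
  where open Enumeration E

witness-≢ : ∀ {n} (p : Fin n → Bool) (z : Fin n) → 2 ≤ count p → ∃[ y ] y ≢ z × p y ≡ true
witness-≢ p z 2≤count = pick unique satisfy (subst (2 ≤_) (sym length-elements) 2≤count)
  where
  open Enumeration (enumerate p)
  pick : ∀ {xs} → Unique xs → All (λ i → p i ≡ true) xs → 2 ≤ length xs
       → ∃[ y ] y ≢ z × p y ≡ true
  pick {[]}          _                _              ()
  pick {_ ∷ []}      _                _              (s≤s ())
  pick {x ∷ y ∷ _} ((x≢y ∷ _) ∷ _) (px ∷ py ∷ _) _ with x ≟ z
  ... | yes refl = y , x≢y ∘ sym , py
  ... | no x≢z   = x , x≢z , px

any-not≡false : ∀ {A : Set} (p : A → Bool) xs
  → any (λ x → not (p x)) xs ≡ false → All (λ x → p x ≡ true) xs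
any-not≡false p []       _ = []
any-not≡false p (x ∷ xs) e =
  not-injective (∨-conicalˡ _ _ e) ∷ any-not≡false p xs (∨-conicalʳ _ _ e)

ore-complement : ∀ r n o i o' i' → o + o' ≡ n → i + i' ≡ n
  → 2 * r * n < suc r * (o + i) → suc r * (o' + i') < 2 * n
ore-complement r n o i o' i' o+o'≡n i+i'≡n ore = +-cancelˡ-< (2 * r * n) _ _ (begin-strict
  2 * r * n + suc r * (o' + i')      <⟨ +-monoˡ-< _ ore ⟩
  suc r * (o + i) + suc r * (o' + i') ≡⟨ regroup r o i o' i' ⟩
  suc r * ((o + o') + (i + i'))       ≡⟨ cong₂ (λ a b → suc r * (a + b)) o+o'≡n i+i'≡n ⟩
  suc r * (n + n)                     ≡⟨ expand r n ⟩
  2 * r * n + 2 * n                   ∎)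
  where
  open ≤-Reasoning
  regroup : ∀ r o i o' i' → suc r * (o + i) + suc r * (o' + i') ≡ suc r * ((o + o') + (i + i'))
  regroup = solve-∀
  expand : ∀ r n → suc r * (n + n) ≡ 2 * r * n + 2 * n
  expand = solve-∀

extend-bound : ∀ r n k c d → r * c < suc k * n → r * d < n → r * (c + d) < suc (suc k) * n
extend-bound r n k c d rc< rd< = begin-strict
  r * (c + d)   ≡⟨ *-distribˡ-+ r c d ⟩
  r * c + r * d <⟨ +-mono-< rc< rd< ⟩
  suc k * n + n ≡⟨ +-comm (suc k * n) n ⟩
  suc (suc k) * n ∎
  where open ≤-Reasoning

-- With b the non-candidates and g the candidates: r·g > m·n ≥ m·r², so g > m·r ≥ m.
enough-candidates : ∀ {r n k m b g} .{{_ : NonZero r}} → r * r ≤ n → k + suc m ≡ r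
  → r * b < suc k * n → b + g ≡ n → m < g
enough-candidates {r} {n} {k} {m} {b} {g} r²≤n k+m+1≡r rb< b+g≡n =
  ≤-<-trans (m≤m*n m r) (*-cancelˡ-< r (m * r) g (begin-strict
    r * (m * r) ≡⟨ rotate r m ⟩
    m * (r * r) ≤⟨ *-monoʳ-≤ m r²≤n ⟩
    m * n       <⟨ mn<rg ⟩
    r * g       ∎))
  where
  open ≤-Reasoning
  rotate : ∀ r m → r * (m * r) ≡ m * (r * r)
  rotate = solve-∀
  split : r * b + r * g ≡ suc k * n + m * n
  split = begin-equality
    r * b + r * g      ≡⟨ *-distribˡ-+ r b g ⟨
    r * (b + g)        ≡⟨ cong (r *_) b+g≡n ⟩
    r * n              ≡⟨ cong (_* n) (trans (sym k+m+1≡r) (+-suc k m)) ⟩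
    (suc k + m) * n    ≡⟨ *-distribʳ-+ n (suc k) m ⟩
    suc k * n + m * n  ∎
  mn<rg : m * n < r * g
  mn<rg = ≰⇒> (λ rg≤mn → <-irrefl split (+-mono-<-≤ rb< rg≤mn))

module DigraphProperties {n : ℕ} (G : Digraph n) where

  infix 4 _⇒_
  _⇒_ : Fin n → Fin n → Set
  x ⇒ y = adj G x y ≡ true

  nonOutdeg nonIndeg : Fin n → ℕ
  nonOutdeg x = count (λ y → not (adj G x y))
  nonIndeg  y = count (λ x → not (adj G x y))

  OreCondition : ℕ → Set
  OreCondition r = ∀ x y → x ≢ y → adj G x y ≡ false → r * (nonOutdeg x + nonIndeg y) < 2 * n

  oreCondition : ∀ r
    → (∀ x y → x ≢ y → adj G x y ≡ false → 2 * r * n < suc r * (outdeg G x + indeg G y))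
    → OreCondition (suc r)
  oreCondition r ore x y x≢y xy∉E =
    ore-complement r n (outdeg G x) (indeg G y) (nonOutdeg x) (nonIndeg y)
      (count-+-count-not (adj G x)) (count-+-count-not (λ v → adj G v y)) (ore x y x≢y xy∉E)

  ¬loop : ∀ {x} → ¬ x ⇒ x
  ¬loop {x} x⇒x with () ← trans (sym (loopless G x)) x⇒x

  lookup-chain : ∀ {xs} → AllPairs _⇒_ xs → (i j : Fin (length xs)) → i F.< j
    → lookup xs i ⇒ lookup xs j
  lookup-chain (x⇒xs ∷ _)    zero    (suc j) _         = All.lookup x⇒xs (∈-lookup j)
  lookup-chain (_ ∷ chain)   (suc i) (suc j) (s≤s i<j) = lookup-chain chain i j i<j

  lookup-chain-injective : ∀ {xs} → AllPairs _⇒_ xs → Injective _≡_ _≡_ (lookup xs)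
  lookup-chain-injective {xs} chain {i} {j} xᵢ≡xⱼ with <-cmp i j
  ... | tri≈ _ i≡j _ = i≡j
  ... | tri< i<j _ _ =
    contradiction (subst (_⇒ lookup xs j) xᵢ≡xⱼ (lookup-chain chain i j i<j)) ¬loop
  ... | tri> _ _ j<i =
    contradiction (subst (_⇒ lookup xs i) (sym xᵢ≡xⱼ) (lookup-chain chain j i j<i)) ¬loop

  chain⇒InTransCopy : ∀ {xs z} → AllPairs _⇒_ xs → z ∈ xs → InTransCopy G (length xs) z
  chain⇒InTransCopy {xs} chain z∈xs =
    record { emb = lookup xs ; inj = lookup-chain-injective chain ; edges = lookup-chain chain }
    , Any.index z∈xs , sym (lookup-index z∈xs)

module Growth {n : ℕ} (G : Digraph n) (r : ℕ) .{{_ : NonZero r}} (r²≤n : r * r ≤ n)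
  (ore : DigraphProperties.OreCondition G r) (z : Fin n) where

  open DigraphProperties G

  cost : List (Fin n) → List (Fin n) → ℕ
  cost L Q = sum (map nonOutdeg L) + sum (map nonIndeg Q)

  misses : List (Fin n) → List (Fin n) → Fin n → Bool
  misses L Q w = any (λ v → not (adj G v w)) L ∨ any (λ v → not (adj G w v)) Q

  count-misses : ∀ L Q → count (misses L Q) ≤ cost L Q
  count-misses L Q =
    ≤-trans (count-∨ (λ w → any (λ v → not (adj G v w)) L) (λ w → any (λ v → not (adj G w v)) Q))
      (+-mono-≤ (count-any (λ v w → not (adj G v w)) L) (count-any (λ v w → not (adj G w v)) Q))

  Compatible : List (Fin n) → List (Fin n) → Fin n → Set
  Compatible L Q w = All (_⇒ w) L × All (w ⇒_) Q

  compatible : ∀ {L Q w} → not (misses L Q w) ≡ true → Compatible L Q w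
  compatible {L} {Q} {w} ¬misses =
    any-not≡false (λ v → adj G v w) L (∨-conicalˡ _ _ misses≡false) ,
    any-not≡false (adj G w) Q (∨-conicalʳ _ _ misses≡false)
    where
    misses≡false : misses L Q w ≡ false
    misses≡false = not-injective ¬misses

  -- The chain left ++ right through z; cost bounds the number of vertices that cannot be
  -- inserted between left and right.
  record Partial (k : ℕ) : Set where
    field
      left right  : List (Fin n)
      size        : length (left ++ right) ≡ k
      left-chain  : AllPairs _⇒_ left
      right-chain : AllPairs _⇒_ right
      left⇒right  : All (λ x → All (x ⇒_) right) left
      covers      : z ∈ left ⊎ z ∈ right
      cheap       : r * cost left right < suc k * n

  cost-snoc : ∀ L Q w → cost (L ++ w ∷ []) Q ≡ cost L Q + nonOutdeg w
  cost-snoc L Q w = begin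
    sum (map nonOutdeg (L ++ w ∷ [])) + sum (map nonIndeg Q)
      ≡⟨ cong (λ ds → sum ds + sum (map nonIndeg Q)) (map-++ nonOutdeg L (w ∷ [])) ⟩
    sum (map nonOutdeg L ++ nonOutdeg w ∷ []) + sum (map nonIndeg Q)
      ≡⟨ cong (_+ sum (map nonIndeg Q)) (sum-++ (map nonOutdeg L) (nonOutdeg w ∷ [])) ⟩
    (sum (map nonOutdeg L) + (nonOutdeg w + 0)) + sum (map nonIndeg Q)
      ≡⟨ regroup (sum (map nonOutdeg L)) (sum (map nonIndeg Q)) (nonOutdeg w) ⟩
    cost L Q + nonOutdeg w ∎
    where
    open ≡-Reasoning
    regroup : ∀ a b d → (a + (d + 0)) + b ≡ (a + b) + d
    regroup = solve-∀

  cost-cons : ∀ L Q w → cost L (w ∷ Q) ≡ cost L Q + nonIndeg w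
  cost-cons L Q w = regroup (sum (map nonOutdeg L)) (sum (map nonIndeg Q)) (nonIndeg w)
    where
    regroup : ∀ a b d → a + (d + b) ≡ (a + b) + d
    regroup = solve-∀

  extendˡ : ∀ {k} (P : Partial k) w → Compatible (Partial.left P) (Partial.right P) w
    → r * nonOutdeg w < n → Partial (suc k)
  extendˡ {k} P w (L⇒w , w⇒Q) light = record
    { left        = L ++ w ∷ []
    ; right       = Q
    ; size        = trans (cong length (++-assoc L (w ∷ []) Q))
                      (trans (length-++-sucʳ L w Q) (cong suc size))
    ; left-chain  = AllPairs.++⁺ left-chain ([] ∷ []) (All.map (_∷ []) L⇒w)
    ; right-chain = right-chain
    ; left⇒right  = All.++⁺ left⇒right (w⇒Q ∷ [])
    ; covers      = Sum.map₁ ∈-++⁺ˡ covers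
    ; cheap       = subst (λ c → r * c < suc (suc k) * n) (sym (cost-snoc L Q w))
                      (extend-bound r n k _ _ cheap light)
    }
    where open Partial P renaming (left to L; right to Q)

  extendʳ : ∀ {k} (P : Partial k) w → Compatible (Partial.left P) (Partial.right P) w
    → r * nonIndeg w < n → Partial (suc k)
  extendʳ {k} P w (L⇒w , w⇒Q) light = record
    { left        = L
    ; right       = w ∷ Q
    ; size        = trans (length-++-sucʳ L w Q) (cong suc size)
    ; left-chain  = left-chain
    ; right-chain = w⇒Q ∷ right-chain
    ; left⇒right  = All.zipWith (uncurry _∷_) (L⇒w , left⇒right)
    ; covers      = Sum.map₂ there covers
    ; cheap       = subst (λ c → r * c < suc (suc k) * n) (sym (cost-cons L Q w))
                      (extend-bound r n k _ _ cheap light)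
    }
    where open Partial P renaming (left to L; right to Q)

  Light : Fin n → Set
  Light w = r * nonOutdeg w < n ⊎ r * nonIndeg w < n

  heavy⇒edge : ∀ {u v} → ¬ Light u → ¬ Light v → u ≢ v → u ⇒ v
  heavy⇒edge {u} {v} heavy-u heavy-v u≢v with adj G u v in uv
  ... | true  = refl
  ... | false = contradiction (ore u v u≢v uv) (≤⇒≯ (begin
    2 * n                              ≡⟨ cong (n +_) (+-identityʳ n) ⟩
    n + n                              ≤⟨ +-mono-≤ (≮⇒≥ (heavy-u ∘ inj₁)) (≮⇒≥ (heavy-v ∘ inj₂)) ⟩
    r * nonOutdeg u + r * nonIndeg v   ≡⟨ *-distribˡ-+ r (nonOutdeg u) (nonIndeg v) ⟨
    r * (nonOutdeg u + nonIndeg v)     ∎))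
    where open ≤-Reasoning

  heavy-chain : ∀ {xs} → Unique xs → All (¬_ ∘ Light) xs → AllPairs _⇒_ xs
  heavy-chain []              []           = []
  heavy-chain (x≢xs ∷ unique) (heavy-x ∷ heavy-xs) =
    All.zipWith (uncurry λ x≢y heavy-y → heavy⇒edge heavy-x heavy-y x≢y) (x≢xs , heavy-xs)
    ∷ heavy-chain unique heavy-xs

  complete : Partial r → InTransCopy G r z
  complete P = subst (λ k → InTransCopy G k z) size (chain⇒InTransCopy
    (AllPairs.++⁺ left-chain right-chain left⇒right) ([ ∈-++⁺ˡ , ∈-++⁺ʳ left ]′ covers))
    where open Partial P

  completeWithClique : ∀ {k m} (P : Partial k) → k + suc m ≡ r → ∀ {cs} → Unique cs
    → All (Compatible (Partial.left P) (Partial.right P)) cs → All (¬_ ∘ Light) cs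
    → suc m ≤ length cs → InTransCopy G r z
  completeWithClique {k} {m} P k+m+1≡r {cs} unique compat heavy m<|cs| =
    subst (λ k → InTransCopy G k z) length-chain (chain⇒InTransCopy
      (AllPairs.++⁺ left-chain (AllPairs.++⁺ B-chain right-chain (All.map proj₂ B-compat))
        (All.zipWith (uncurry All.++⁺) (All.All-swap (All.map proj₁ B-compat) , left⇒right)))
      z∈chain)
    where
    open Partial P renaming (left to L; right to Q)
    B : List (Fin n)
    B = take (suc m) cs
    B-compat : All (Compatible L Q) B
    B-compat = All.take⁺ (suc m) compat
    B-chain : AllPairs _⇒_ B
    B-chain = heavy-chain (Unique.take⁺ (suc m) unique) (All.take⁺ (suc m) heavy)
    z∈chain : z ∈ L ++ B ++ Q
    z∈chain = [ ∈-++⁺ˡ , ∈-++⁺ʳ L ∘ ∈-++⁺ʳ B ]′ covers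
    length-chain : length (L ++ B ++ Q) ≡ r
    length-chain = begin
      length (L ++ B ++ Q)               ≡⟨ length-++ L ⟩
      length L + length (B ++ Q)         ≡⟨ cong (length L +_) (length-++ B) ⟩
      length L + (length B + length Q)   ≡⟨ cong (λ b → length L + (b + length Q))
                                              (trans (length-take (suc m) cs) (m≤n⇒m⊓n≡m m<|cs|)) ⟩
      length L + (suc m + length Q)      ≡⟨ regroup (length L) (suc m) (length Q) ⟩
      (length L + length Q) + suc m      ≡⟨ cong (_+ suc m) (trans (sym (length-++ L)) size) ⟩
      k + suc m                          ≡⟨ k+m+1≡r ⟩
      r                                  ∎
      where
      open ≡-Reasoning
      regroup : ∀ a b c → a + (b + c) ≡ (a + c) + b
      regroup = solve-∀

  grow : ∀ {k m} → k + suc m ≡ r → Partial k → Partial (suc k) ⊎ InTransCopy G r z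
  grow {k} {m} k+m+1≡r P = case any? light? elements of λ where
      (yes some-light) → inj₁ (extend (All.lookupAny candidates-compatible some-light))
      (no none-light)  → inj₂ (completeWithClique P k+m+1≡r unique candidates-compatible
        (All.¬Any⇒All¬ elements none-light) (subst (suc m ≤_) (sym length-elements)
          (enough-candidates r²≤n k+m+1≡r (≤-<-trans (*-monoʳ-≤ r (count-misses L Q)) cheap)
            (count-+-count-not (misses L Q)))))
    where
    open Partial P renaming (left to L; right to Q)
    open Enumeration (enumerate (not ∘ misses L Q))
    light? : ∀ w → Dec (Light w)
    light? w = (r * nonOutdeg w <? n) ⊎-dec (r * nonIndeg w <? n)
    candidates-compatible : All (Compatible L Q) elements
    candidates-compatible = All.map compatible satisfy
    extend : ∀ {w} → Compatible L Q w × Light w → Partial (suc k)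
    extend (compat , inj₁ light) = extendˡ P _ compat light
    extend (compat , inj₂ light) = extendʳ P _ compat light

  reach : ∀ m {k} → k + m ≡ r → Partial k → InTransCopy G r z
  reach zero    k+0≡r   P = complete (subst Partial (trans (sym (+-identityʳ _)) k+0≡r) P)
  reach (suc m) k+m+1≡r P =
    [ reach m (trans (sym (+-suc _ m)) k+m+1≡r) , id ] (grow k+m+1≡r P)

  start-cheap : r * nonOutdeg z < 2 * n
  start-cheap with 2 ≤? nonOutdeg z
  ... | yes 2≤d with witness-≢ (λ y → not (adj G z y)) z 2≤d
  ...   | y , y≢z , zy∉E =
    ≤-<-trans (*-monoʳ-≤ r (m≤m+n _ _)) (ore z y (y≢z ∘ sym) (not-injective zy∉E))
  start-cheap | no d≱2 = begin-strict
    r * nonOutdeg z ≤⟨ *-monoʳ-≤ r (≤-pred (≰⇒> d≱2)) ⟩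
    r * 1           ≡⟨ *-identityʳ r ⟩
    r               ≤⟨ m≤m*n r r ⟩
    r * r           ≤⟨ r²≤n ⟩
    n               <⟨ m<m+n n (<-≤-trans (≤-<-trans z≤n (toℕ<n z)) (m≤m+n n 0)) ⟩
    2 * n           ∎
    where open ≤-Reasoning

  start : Partial 1
  start = record
    { left        = z ∷ []
    ; right       = []
    ; size        = refl
    ; left-chain  = [] ∷ []
    ; right-chain = []
    ; left⇒right  = [] ∷ []
    ; covers      = inj₁ (here refl)
    ; cheap       = subst (λ c → r * c < 2 * n)
                      (sym (trans (+-identityʳ _) (+-identityʳ _))) start-cheap
    }

  inTransCopy : InTransCopy G r z
  inTransCopy = reach (pred r) (suc-pred r) start

fact6p3 : (n r : ℕ) → r * r ≤ n → 2 ≤ r → (G : Digraph n)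
    → (∀ (x y : Fin n) → x ≢ y → adj G x y ≡ false
         → 2 * (r ∸ 1) * n < r * (outdeg G x + indeg G y))
    → (z : Fin n) → InTransCopy G r z
fact6p3 n zero    _    () G ore z
fact6p3 n (suc r) r²≤n _ G ore z =
  Growth.inTransCopy G (suc r) r²≤n (DigraphProperties.oreCondition G r ore) z
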